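{- Let $n$ be a positive integer. Then $$\sum_{m=0}^{n}(-1)^m\binom{n-1}{n-m}\frac{n!}{m+1}=\sum_{m=0}^{n+1}(-1)^{m+n}S_1(n,m)B_m.$$
   Context: The (signed) Stirling numbers of the first kind $S_1(n,m)$ are defined by $x(x-1)\cdots(x-n+1)=\sum_{m=0}^nS_1(n,m)x^m$, with $S_1(n,m)=0$ for $m>n$. The Bernoulli numbers $B_m$ are defined by $\frac{t}{e^t-1}=\sum_{m\ge0}B_m\frac{t^m}{m!}$. $\binom{a}{b}=0$ if $b>a$. -}

module Defs where

open import Data.Nat as ℕ using (ℕ; zero; suc; _∸_)
open import Data.Nat.Combinatorics using (_C_)
open import Data.Integer as ℤ using (ℤ; +_)
open import Data.Rational as ℚ using (ℚ; _+_; _*_; -_; _/_; 0ℚ; 1ℚ)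
open import Relation.Nullary using (yes; no)

sumℚ : ℕ → (ℕ → ℚ) → ℚ
sumℚ zero    f = 0ℚ
sumℚ (suc n) f = sumℚ n f + f n

sign : ℕ → ℚ
sign zero    = 1ℚ
sign (suc m) = - sign m

ℕ→ℚ : ℕ → ℚ
ℕ→ℚ n = (+ n) / 1

ℤ→ℚ : ℤ → ℚ
ℤ→ℚ z = z / 1

-- Signed Stirling numbers of the first kind:
-- x(x-1)...(x-n+1) = Σ_m S₁ n m x^m, via the recurrence
-- S₁(n+1,m+1) = S₁(n,m) - n S₁(n,m+1), S₁(0,0)=1, S₁(0,m+1)=0, S₁(n+1,0)=0.
S₁ : ℕ → ℕ → ℤ
S₁ zero    zero    = + 1
S₁ zero    (suc m) = + 0
S₁ (suc n) zero    = + 0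
S₁ (suc n) (suc m) = S₁ n m ℤ.- (+ n) ℤ.* S₁ n (suc m)

-- Bernoulli numbers with t/(e^t-1) = Σ B_m t^m/m!  (so B₁ = -1/2):
-- B₀ = 1,  B_n = -(1/(n+1)) Σ_{k=0}^{n-1} C(n+1,k) B_k  for n ≥ 1.
-- Defined via the list of the first values to keep recursion structural.
-- bernoulliTable n k = B_k for k ≤ n (course-of-values bernoulliTable)
bernoulliTable : ℕ → (ℕ → ℚ)
bernoulliTable zero    k = 1ℚ
bernoulliTable (suc n) k with k ℕ.≤? n
... | yes _ = bernoulliTable n k
... | no  _ =
    - ((+ 1 / suc (suc n)) * sumℚ (suc n) (λ j → ℕ→ℚ (suc (suc n) C j) * bernoulliTable n j))

bernoulli : ℕ → ℚ
bernoulli n = bernoulliTable n n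

open import Relation.Binary.PropositionalEquality using (_≡_; refl)
private
  _ : bernoulli 1 ≡ - ((+ 1) / 2)
  _ = refl
  _ : bernoulli 2 ≡ (+ 1) / 6
  _ = refl
  _ : bernoulli 3 ≡ 0ℚ
  _ = refl
  _ : bernoulli 4 ≡ - ((+ 1) / 30)
  _ = refl
  _ : S₁ 3 1 ≡ + 2
  _ = refl
  _ : S₁ 3 2 ≡ ℤ.- (+ 3)
  _ = refl

-- Both sides equal -(n-1)!/(n+1).
--
-- Left side: with m = j + 1 it is -n! Σ_j (-1)^j C(n-1,j)/(j+2), a multiple of the Beta integral
-- ∫₀¹ x (1-x)^(n-1) dx, and the Pascal recurrence of these integrals gives
-- Σ_j (-1)^j C(p,j)/(r+j+1) = p!/((r+1)(r+2)⋯(r+p+1)).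
--
-- Right side: (-1)^(n+m) S₁(n,m) are the coefficients of x⁽ⁿ⁾ = x(x+1)⋯(x+n-1), so the side is the
-- umbral value of x⁽ⁿ⁾ under x^m ↦ B_m. Let R n and S n be the umbral values of x⁽ⁿ⁾ and (x+1)⁽ⁿ⁾.
-- The Bernoulli recursion says p(B+1) = p(B) + p'(0), so S n = R n + (n-1)!, and
-- x (x+1)⁽ⁿ⁾ = (x+1)⁽ⁿ⁺¹⁾ - (n+1) (x+1)⁽ⁿ⁾ gives R (n+1) = S (n+1) - (n+1) S n. Together they force
-- (n+1) S n = n!, hence R n = n!/(n+1) - (n-1)!.

module Submission where

open import Defs
open import Data.Nat using (ℕ; suc; _∸_; _+_; _!; NonZero)
open import Data.Nat.Combinatorics using (_C_)
open import Data.Integer using (+_)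
open import Data.Rational using (ℚ; _*_; _/_)
open import Relation.Binary.PropositionalEquality using (_≡_)

open import Data.Nat as ℕ using (zero; _<_; _≤_; z≤n)
import Data.Nat.Properties as ℕ
import Data.Nat.Combinatorics as ℕ
import Data.Integer as ℤ
import Data.Integer.Properties as ℤ
open import Data.Rational as ℚ using (-_; _-_; 0ℚ; 1ℚ; toℚᵘ) renaming (_+_ to _⊕_)
import Data.Rational.Properties as ℚ
import Data.Rational.Unnormalised as ℚᵘ
import Data.Rational.Unnormalised.Properties as ℚᵘ
open import Data.Sum using (inj₁; inj₂)
open import Level using (0ℓ)
open import Relation.Binary.PropositionalEquality using (refl; sym; trans; cong; cong₂; module ≡-Reasoning)
open import Relation.Nullary using (yes; no; contradiction)
open import Relation.Nullary.Decidable using (dec⇒maybe)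
import Tactic.RingSolver.Core.AlmostCommutativeRing as ACR
open import Tactic.RingSolver using (solve-∀)

ℚ-ring : ACR.AlmostCommutativeRing 0ℓ 0ℓ
ℚ-ring = ACR.fromCommutativeRing ℚ.+-*-commutativeRing (λ p → dec⇒maybe (0ℚ ℚ.≟ p))

*-distribˡ-sub : ∀ a b c → a * (b - c) ≡ a * b - a * c
*-distribˡ-sub = solve-∀ ℚ-ring

toℚᵘ-ℤ→ℚ : ∀ z → toℚᵘ (ℤ→ℚ z) ℚᵘ.≃ ℚᵘ.mkℚᵘ z 0
toℚᵘ-ℤ→ℚ z = ℚ.toℚᵘ-fromℚᵘ (ℚᵘ.mkℚᵘ z 0)

ℤ→ℚ-+ : ∀ a b → ℤ→ℚ (a ℤ.+ b) ≡ ℤ→ℚ a ⊕ ℤ→ℚ b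
ℤ→ℚ-+ a b = ℚ.toℚᵘ-injective (begin
  toℚᵘ (ℤ→ℚ (a ℤ.+ b))                 ≈⟨ toℚᵘ-ℤ→ℚ (a ℤ.+ b) ⟩
  ℚᵘ.mkℚᵘ (a ℤ.+ b) 0                   ≈⟨ ℚᵘ.*≡* (cong₂ (λ x y → (x ℤ.+ y) ℤ.* + 1)
                                                         (sym (ℤ.*-identityʳ a)) (sym (ℤ.*-identityʳ b))) ⟩
  ℚᵘ.mkℚᵘ a 0 ℚᵘ.+ ℚᵘ.mkℚᵘ b 0           ≈⟨ ℚᵘ.+-cong (toℚᵘ-ℤ→ℚ a) (toℚᵘ-ℤ→ℚ b) ⟨
  toℚᵘ (ℤ→ℚ a) ℚᵘ.+ toℚᵘ (ℤ→ℚ b)         ≈⟨ ℚ.toℚᵘ-homo-+ (ℤ→ℚ a) (ℤ→ℚ b) ⟨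
  toℚᵘ (ℤ→ℚ a ⊕ ℤ→ℚ b)                 ∎)
  where open ℚᵘ.≃-Reasoning

ℤ→ℚ-* : ∀ a b → ℤ→ℚ (a ℤ.* b) ≡ ℤ→ℚ a * ℤ→ℚ b
ℤ→ℚ-* a b = ℚ.toℚᵘ-injective (begin
  toℚᵘ (ℤ→ℚ (a ℤ.* b))                 ≈⟨ toℚᵘ-ℤ→ℚ (a ℤ.* b) ⟩
  ℚᵘ.mkℚᵘ a 0 ℚᵘ.* ℚᵘ.mkℚᵘ b 0           ≈⟨ ℚᵘ.*-cong (toℚᵘ-ℤ→ℚ a) (toℚᵘ-ℤ→ℚ b) ⟨
  toℚᵘ (ℤ→ℚ a) ℚᵘ.* toℚᵘ (ℤ→ℚ b)         ≈⟨ ℚ.toℚᵘ-homo-* (ℤ→ℚ a) (ℤ→ℚ b) ⟨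
  toℚᵘ (ℤ→ℚ a * ℤ→ℚ b)                 ∎)
  where open ℚᵘ.≃-Reasoning

ℤ→ℚ-neg : ∀ a → ℤ→ℚ (ℤ.- a) ≡ - ℤ→ℚ a
ℤ→ℚ-neg a = ℚ.toℚᵘ-injective (begin
  toℚᵘ (ℤ→ℚ (ℤ.- a))    ≈⟨ toℚᵘ-ℤ→ℚ (ℤ.- a) ⟩
  ℚᵘ.- ℚᵘ.mkℚᵘ a 0       ≈⟨ ℚᵘ.-‿cong (toℚᵘ-ℤ→ℚ a) ⟨
  ℚᵘ.- toℚᵘ (ℤ→ℚ a)      ≈⟨ ℚ.toℚᵘ-homo‿- (ℤ→ℚ a) ⟨
  toℚᵘ (- ℤ→ℚ a)        ∎)
  where open ℚᵘ.≃-Reasoning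

ℕ→ℚ-+ : ∀ a b → ℕ→ℚ (a + b) ≡ ℕ→ℚ a ⊕ ℕ→ℚ b
ℕ→ℚ-+ a b = trans (cong ℤ→ℚ (ℤ.pos-+ a b)) (ℤ→ℚ-+ (+ a) (+ b))

ℕ→ℚ-* : ∀ a b → ℕ→ℚ (a ℕ.* b) ≡ ℕ→ℚ a * ℕ→ℚ b
ℕ→ℚ-* a b = trans (cong ℤ→ℚ (ℤ.pos-* a b)) (ℤ→ℚ-* (+ a) (+ b))

ℕ→ℚ-suc : ∀ a → ℕ→ℚ (suc a) ≡ 1ℚ ⊕ ℕ→ℚ a
ℕ→ℚ-suc = ℕ→ℚ-+ 1

1/suc : ℕ → ℚ
1/suc k = + 1 / suc k

/suc≡*1/suc : ∀ a k → + a / suc k ≡ ℕ→ℚ a * 1/suc k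
/suc≡*1/suc a k = ℚ.toℚᵘ-injective (begin
  toℚᵘ (+ a / suc k)                        ≈⟨ ℚ.toℚᵘ-fromℚᵘ (ℚᵘ.mkℚᵘ (+ a) k) ⟩
  ℚᵘ.mkℚᵘ (+ a) k                            ≈⟨ ℚᵘ.*≡* (trans (cong (λ d → + a ℤ.* + suc d) (ℕ.+-identityʳ k))
                                                        (cong (ℤ._* + suc k) (sym (ℤ.*-identityʳ (+ a))))) ⟩
  ℚᵘ.mkℚᵘ (+ a) 0 ℚᵘ.* ℚᵘ.mkℚᵘ (+ 1) k        ≈⟨ ℚᵘ.*-cong (toℚᵘ-ℤ→ℚ (+ a))
                                                             (ℚ.toℚᵘ-fromℚᵘ (ℚᵘ.mkℚᵘ (+ 1) k)) ⟨
  toℚᵘ (ℕ→ℚ a) ℚᵘ.* toℚᵘ (1/suc k)           ≈⟨ ℚ.toℚᵘ-homo-* (ℕ→ℚ a) (1/suc k) ⟨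
  toℚᵘ (ℕ→ℚ a * 1/suc k)                    ∎)
  where open ℚᵘ.≃-Reasoning

ℕ→ℚ-suc-*-1/suc : ∀ k → ℕ→ℚ (suc k) * 1/suc k ≡ 1ℚ
ℕ→ℚ-suc-*-1/suc k = trans (sym (/suc≡*1/suc (suc k) k)) (ℚ.toℚᵘ-injective (begin
  toℚᵘ (+ suc k / suc k)  ≈⟨ ℚ.toℚᵘ-fromℚᵘ (ℚᵘ.mkℚᵘ (+ suc k) k) ⟩
  ℚᵘ.mkℚᵘ (+ suc k) k     ≈⟨ ℚᵘ.*≡* (ℤ.*-comm (+ suc k) (+ 1)) ⟩
  ℚᵘ.1ℚᵘ                  ∎))
  where open ℚᵘ.≃-Reasoning

ℕ→ℚ-suc-*-cancelˡ : ∀ k {x y} → ℕ→ℚ (suc k) * x ≡ ℕ→ℚ (suc k) * y → x ≡ y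
ℕ→ℚ-suc-*-cancelˡ k {x} {y} eq = begin
  x                              ≡⟨ unscale x ⟨
  1/suc k * (ℕ→ℚ (suc k) * x)    ≡⟨ cong (1/suc k *_) eq ⟩
  1/suc k * (ℕ→ℚ (suc k) * y)    ≡⟨ unscale y ⟩
  y                              ∎
  where
  open ≡-Reasoning
  unscale : ∀ z → 1/suc k * (ℕ→ℚ (suc k) * z) ≡ z
  unscale z = begin
    1/suc k * (ℕ→ℚ (suc k) * z)   ≡⟨ ℚ.*-assoc (1/suc k) (ℕ→ℚ (suc k)) z ⟨
    (1/suc k * ℕ→ℚ (suc k)) * z   ≡⟨ cong (_* z) (trans (ℚ.*-comm (1/suc k) (ℕ→ℚ (suc k)))
                                                          (ℕ→ℚ-suc-*-1/suc k)) ⟩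
    1ℚ * z                        ≡⟨ ℚ.*-identityˡ z ⟩
    z                             ∎

sumℚ-cong< : ∀ n {f g : ℕ → ℚ} → (∀ i → i < n → f i ≡ g i) → sumℚ n f ≡ sumℚ n g
sumℚ-cong< zero    f≡g = refl
sumℚ-cong< (suc n) f≡g =
  cong₂ _⊕_ (sumℚ-cong< n (λ i i<n → f≡g i (ℕ.m<n⇒m<1+n i<n))) (f≡g n (ℕ.n<1+n n))

sumℚ-cong : ∀ n {f g : ℕ → ℚ} → (∀ i → f i ≡ g i) → sumℚ n f ≡ sumℚ n g
sumℚ-cong n f≡g = sumℚ-cong< n (λ i _ → f≡g i)

sumℚ-+ : ∀ n (f g : ℕ → ℚ) → sumℚ n (λ i → f i ⊕ g i) ≡ sumℚ n f ⊕ sumℚ n g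
sumℚ-+ zero    f g = refl
sumℚ-+ (suc n) f g =
  trans (cong (_⊕ (f n ⊕ g n)) (sumℚ-+ n f g)) (interchange (sumℚ n f) (sumℚ n g) (f n) (g n))
  where
  interchange : ∀ a b c d → (a ⊕ b) ⊕ (c ⊕ d) ≡ (a ⊕ c) ⊕ (b ⊕ d)
  interchange = solve-∀ ℚ-ring

sumℚ-*ˡ : ∀ n c (f : ℕ → ℚ) → sumℚ n (λ i → c * f i) ≡ c * sumℚ n f
sumℚ-*ˡ zero    c f = sym (ℚ.*-zeroʳ c)
sumℚ-*ˡ (suc n) c f =
  trans (cong (_⊕ c * f n) (sumℚ-*ˡ n c f)) (sym (ℚ.*-distribˡ-+ c (sumℚ n f) (f n)))

sumℚ-*ʳ : ∀ n c (f : ℕ → ℚ) → sumℚ n (λ i → f i * c) ≡ sumℚ n f * c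
sumℚ-*ʳ n c f = trans (sumℚ-cong n (λ i → ℚ.*-comm (f i) c))
                      (trans (sumℚ-*ˡ n c f) (ℚ.*-comm c (sumℚ n f)))

sumℚ-neg : ∀ n (f : ℕ → ℚ) → sumℚ n (λ i → - f i) ≡ - sumℚ n f
sumℚ-neg zero    f = refl
sumℚ-neg (suc n) f =
  trans (cong (_⊕ - f n) (sumℚ-neg n f)) (sym (ℚ.neg-distrib-+ (sumℚ n f) (f n)))

sumℚ-zero : ∀ n → sumℚ n (λ _ → 0ℚ) ≡ 0ℚ
sumℚ-zero zero    = refl
sumℚ-zero (suc n) = trans (ℚ.+-identityʳ _) (sumℚ-zero n)

sumℚ-suc-head : ∀ n (f : ℕ → ℚ) → sumℚ (suc n) f ≡ f 0 ⊕ sumℚ n (λ i → f (suc i))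
sumℚ-suc-head zero    f = trans (ℚ.+-identityˡ (f 0)) (sym (ℚ.+-identityʳ (f 0)))
sumℚ-suc-head (suc n) f = trans (cong (_⊕ f (suc n)) (sumℚ-suc-head n f)) (ℚ.+-assoc (f 0) _ _)

sumℚ-extend : ∀ d n (f : ℕ → ℚ) → (∀ i → n ≤ i → f i ≡ 0ℚ) → sumℚ (d + n) f ≡ sumℚ n f
sumℚ-extend zero    n f vanish = refl
sumℚ-extend (suc d) n f vanish =
  trans (cong₂ _⊕_ (sumℚ-extend d n f vanish) (vanish (d + n) (ℕ.m≤n+m n d))) (ℚ.+-identityʳ _)

sumℚ-swap : ∀ n m (f : ℕ → ℕ → ℚ) →
            sumℚ n (λ i → sumℚ m (λ j → f i j)) ≡ sumℚ m (λ j → sumℚ n (λ i → f i j))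
sumℚ-swap zero    m f = sym (sumℚ-zero m)
sumℚ-swap (suc n) m f = trans (cong (_⊕ sumℚ m (f n)) (sumℚ-swap n m f))
                              (sym (sumℚ-+ m (λ j → sumℚ n (λ i → f i j)) (f n)))

binom : ℕ → ℕ → ℚ
binom m k = ℕ→ℚ (m C k)

binom-vanish : ∀ {m k} → m < k → binom m k ≡ 0ℚ
binom-vanish m<k = cong ℕ→ℚ (ℕ.k>n⇒nCk≡0 m<k)

binom-pascal : ∀ m k → binom (suc m) (suc k) ≡ binom m k ⊕ binom m (suc k)
binom-pascal m k = trans (cong ℕ→ℚ (sym (ℕ.nCk+nC[k+1]≡[n+1]C[k+1] m k))) (ℕ→ℚ-+ (m C k) (m C suc k))

-- Unsigned Stirling numbers: the coefficients of the rising factorial x(x+1)⋯(x+n-1).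
stirling : ℕ → ℕ → ℚ
stirling n m = sign (m + n) * ℤ→ℚ (S₁ n m)

stirling-suc : ∀ n m → stirling (suc n) (suc m) ≡ stirling n m ⊕ ℕ→ℚ n * stirling n (suc m)
stirling-suc n m = begin
  sign (suc m + suc n) * ℤ→ℚ (S₁ n m ℤ.- + n ℤ.* S₁ n (suc m))
    ≡⟨ cong₂ _*_ (cong -_ (cong sign (ℕ.+-suc m n)))
                 (trans (ℤ→ℚ-+ (S₁ n m) (ℤ.- (+ n ℤ.* S₁ n (suc m)))) (cong (ℤ→ℚ (S₁ n m) ⊕_)
                    (trans (ℤ→ℚ-neg (+ n ℤ.* S₁ n (suc m))) (cong -_ (ℤ→ℚ-* (+ n) (S₁ n (suc m))))))) ⟩
  - - s * (ℤ→ℚ (S₁ n m) ⊕ - (ℕ→ℚ n * ℤ→ℚ (S₁ n (suc m))))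
    ≡⟨ rearrange s (ℤ→ℚ (S₁ n m)) (ℕ→ℚ n) (ℤ→ℚ (S₁ n (suc m))) ⟩
  s * ℤ→ℚ (S₁ n m) ⊕ ℕ→ℚ n * (- s * ℤ→ℚ (S₁ n (suc m)))
    ∎
  where
  open ≡-Reasoning
  s = sign (m + n)
  rearrange : ∀ s a k b → - - s * (a ⊕ - (k * b)) ≡ s * a ⊕ k * (- s * b)
  rearrange = solve-∀ ℚ-ring

stirling-suc-zero : ∀ n → stirling (suc n) 0 ≡ 0ℚ
stirling-suc-zero n = ℚ.*-zeroʳ (sign (suc n))

ℕ→ℚ-*-stirling-zero : ∀ n → ℕ→ℚ n * stirling n 0 ≡ 0ℚ
ℕ→ℚ-*-stirling-zero zero    = ℚ.*-zeroˡ (stirling 0 0)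
ℕ→ℚ-*-stirling-zero (suc n) = trans (cong (ℕ→ℚ (suc n) *_) (stirling-suc-zero n)) (ℚ.*-zeroʳ (ℕ→ℚ (suc n)))

stirling-vanish : ∀ {n m} → n < m → stirling n m ≡ 0ℚ
stirling-vanish {zero}  {suc m} _ = ℚ.*-zeroʳ (sign (suc m + 0))
stirling-vanish {suc n} {suc m} (ℕ.s≤s n<m) = begin
  stirling (suc n) (suc m)                         ≡⟨ stirling-suc n m ⟩
  stirling n m ⊕ ℕ→ℚ n * stirling n (suc m)        ≡⟨ cong₂ (λ a b → a ⊕ ℕ→ℚ n * b) (stirling-vanish n<m)
                                                          (stirling-vanish (ℕ.m<n⇒m<1+n n<m)) ⟩
  0ℚ ⊕ ℕ→ℚ n * 0ℚ                                  ≡⟨ cong (0ℚ ⊕_) (ℚ.*-zeroʳ (ℕ→ℚ n)) ⟩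
  0ℚ                                               ∎
  where open ≡-Reasoning

stirling-one : ∀ n → stirling (suc n) 1 ≡ ℕ→ℚ (n !)
stirling-one zero    = refl
stirling-one (suc n) = begin
  stirling (suc (suc n)) 1                          ≡⟨ stirling-suc (suc n) 0 ⟩
  stirling (suc n) 0 ⊕ ℕ→ℚ (suc n) * stirling (suc n) 1
                                                    ≡⟨ cong₂ _⊕_ (stirling-suc-zero n)
                                                                 (cong (ℕ→ℚ (suc n) *_) (stirling-one n)) ⟩
  0ℚ ⊕ ℕ→ℚ (suc n) * ℕ→ℚ (n !)                      ≡⟨ ℚ.+-identityˡ _ ⟩
  ℕ→ℚ (suc n) * ℕ→ℚ (n !)                           ≡⟨ ℕ→ℚ-* (suc n) (n !) ⟨
  ℕ→ℚ (suc n !)                                     ∎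
  where open ≡-Reasoning

ℕ→ℚ-*-sumℚ-stirling-tail : ∀ n (g : ℕ → ℚ) →
  ℕ→ℚ n * sumℚ (suc (suc n)) (λ m → stirling n (suc m) * g (suc m))
  ≡ ℕ→ℚ n * sumℚ (suc (suc n)) (λ m → stirling n m * g m)
ℕ→ℚ-*-sumℚ-stirling-tail n g = begin
  N * sumℚ (suc (suc n)) (λ m → term (suc m))
    ≡⟨ ℚ.+-identityˡ _ ⟨
  0ℚ ⊕ N * sumℚ (suc (suc n)) (λ m → term (suc m))
    ≡⟨ cong (_⊕ N * sumℚ (suc (suc n)) (λ m → term (suc m))) head-vanishes ⟨
  N * term 0 ⊕ N * sumℚ (suc (suc n)) (λ m → term (suc m))
    ≡⟨ ℚ.*-distribˡ-+ N _ _ ⟨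
  N * (term 0 ⊕ sumℚ (suc (suc n)) (λ m → term (suc m)))
    ≡⟨ cong (N *_) (sumℚ-suc-head (suc (suc n)) term) ⟨
  N * sumℚ (suc (suc (suc n))) term
    ≡⟨ cong (N *_) (sumℚ-extend 1 (suc (suc n)) term beyond-n) ⟩
  N * sumℚ (suc (suc n)) term
    ∎
  where
  open ≡-Reasoning
  N = ℕ→ℚ n
  term : ℕ → ℚ
  term m = stirling n m * g m
  head-vanishes : N * term 0 ≡ 0ℚ
  head-vanishes = trans (sym (ℚ.*-assoc N (stirling n 0) (g 0)))
                        (trans (cong (_* g 0) (ℕ→ℚ-*-stirling-zero n)) (ℚ.*-zeroˡ (g 0)))
  beyond-n : ∀ m → suc (suc n) ≤ m → term m ≡ 0ℚ
  beyond-n m n+2≤m = trans (cong (_* g m) (stirling-vanish {n} (ℕ.<⇒≤ n+2≤m))) (ℚ.*-zeroˡ (g m))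

sumℚ-*-binom-pascal : ∀ N (f : ℕ → ℚ) k →
  sumℚ N (λ m → f m * binom (suc m) (suc k))
  ≡ sumℚ N (λ m → f m * binom m k) ⊕ sumℚ N (λ m → f m * binom m (suc k))
sumℚ-*-binom-pascal N f k = trans
  (sumℚ-cong N (λ m → trans (cong (f m *_) (binom-pascal m k))
                             (ℚ.*-distribˡ-+ (f m) (binom m k) (binom m (suc k)))))
  (sumℚ-+ N (λ m → f m * binom m k) (λ m → f m * binom m (suc k)))

-- Coefficientwise form of (x+1)(x+2)⋯(x+n) = x(x+1)⋯(x+n) / x, expanding the left side by
-- the binomial theorem.
stirling-binomial-sum : ∀ n k →
  sumℚ (suc (suc n)) (λ m → stirling n m * binom m k) ≡ stirling (suc n) (suc k)
stirling-binomial-sum zero zero    = refl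
stirling-binomial-sum zero (suc k) = begin
  (0ℚ ⊕ stirling 0 0 * binom 0 (suc k)) ⊕ stirling 0 1 * binom 1 (suc k)
    ≡⟨ cong₂ (λ a b → (0ℚ ⊕ stirling 0 0 * a) ⊕ b * binom 1 (suc k))
             (binom-vanish {0} {suc k} (ℕ.s≤s z≤n)) (stirling-vanish {0} {1} (ℕ.s≤s z≤n)) ⟩
  (0ℚ ⊕ stirling 0 0 * 0ℚ) ⊕ 0ℚ * binom 1 (suc k)
    ≡⟨ cong ((0ℚ ⊕ stirling 0 0 * 0ℚ) ⊕_) (ℚ.*-zeroˡ (binom 1 (suc k))) ⟩
  0ℚ
    ≡⟨ stirling-vanish {1} {suc (suc k)} (ℕ.s≤s (ℕ.s≤s z≤n)) ⟨
  stirling 1 (suc (suc k))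
    ∎
  where open ≡-Reasoning
stirling-binomial-sum (suc n) k = begin
  sumℚ (suc (suc (suc n))) (λ m → stirling (suc n) m * binom m k)
    ≡⟨ sumℚ-suc-head (suc (suc n)) _ ⟩
  stirling (suc n) 0 * binom 0 k ⊕ sumℚ L (λ m → stirling (suc n) (suc m) * binom (suc m) k)
    ≡⟨ cong₂ _⊕_ (trans (cong (_* binom 0 k) (stirling-suc-zero n)) (ℚ.*-zeroˡ (binom 0 k)))
                 (sumℚ-cong L split) ⟩
  0ℚ ⊕ sumℚ L (λ m → stirling n m * binom (suc m) k ⊕ N * shifted m)
    ≡⟨ trans (ℚ.+-identityˡ _) (sumℚ-+ L _ _) ⟩
  sumℚ L (λ m → stirling n m * binom (suc m) k) ⊕ sumℚ L (λ m → N * shifted m)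
    ≡⟨ cong (sumℚ L (λ m → stirling n m * binom (suc m) k) ⊕_) (sumℚ-*ˡ L N shifted) ⟩
  sumℚ L (λ m → stirling n m * binom (suc m) k) ⊕ N * sumℚ L shifted
    ≡⟨ cong₂ _⊕_ (pascal-side k) (trans (ℕ→ℚ-*-sumℚ-stirling-tail n (λ m → binom m k))
                                        (cong (N *_) (stirling-binomial-sum n k))) ⟩
  (stirling (suc n) k ⊕ stirling (suc n) (suc k)) ⊕ N * stirling (suc n) (suc k)
    ≡⟨ collect (stirling (suc n) k) (stirling (suc n) (suc k)) N ⟩
  stirling (suc n) k ⊕ (1ℚ ⊕ N) * stirling (suc n) (suc k)
    ≡⟨ cong (λ t → stirling (suc n) k ⊕ t * stirling (suc n) (suc k)) (ℕ→ℚ-suc n) ⟨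
  stirling (suc n) k ⊕ ℕ→ℚ (suc n) * stirling (suc n) (suc k)
    ≡⟨ stirling-suc (suc n) k ⟨
  stirling (suc (suc n)) (suc k)
    ∎
  where
  open ≡-Reasoning
  L = suc (suc n)
  N = ℕ→ℚ n
  shifted : ℕ → ℚ
  shifted m = stirling n (suc m) * binom (suc m) k

  split : ∀ m → stirling (suc n) (suc m) * binom (suc m) k ≡ stirling n m * binom (suc m) k ⊕ N * shifted m
  split m = trans (cong (_* binom (suc m) k) (stirling-suc n m))
                  (trans (ℚ.*-distribʳ-+ (binom (suc m) k) (stirling n m) (N * stirling n (suc m)))
                         (cong (stirling n m * binom (suc m) k ⊕_)
                               (ℚ.*-assoc N (stirling n (suc m)) (binom (suc m) k))))

  collect : ∀ a b c → (a ⊕ b) ⊕ c * b ≡ a ⊕ (1ℚ ⊕ c) * b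
  collect = solve-∀ ℚ-ring

  pascal-side : ∀ k → sumℚ L (λ m → stirling n m * binom (suc m) k)
                      ≡ stirling (suc n) k ⊕ stirling (suc n) (suc k)
  -- binom (suc m) 0 and binom m 0 both compute to 1.
  pascal-side zero    = trans (stirling-binomial-sum n 0)
    (sym (trans (cong (_⊕ stirling (suc n) 1) (stirling-suc-zero n)) (ℚ.+-identityˡ (stirling (suc n) 1))))
  pascal-side (suc k) = trans (sumℚ-*-binom-pascal L (stirling n) k)
                              (cong₂ _⊕_ (stirling-binomial-sum n k) (stirling-binomial-sum n (suc k)))

bernoulliTable-suc : ∀ {n k} → k ≤ n → bernoulliTable (suc n) k ≡ bernoulliTable n k
bernoulliTable-suc {n} {k} k≤n with k ℕ.≤? n
... | yes _   = refl
... | no  k≰n = contradiction k≤n k≰n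

bernoulliTable-stable : ∀ {n k} → k ≤ n → bernoulliTable n k ≡ bernoulli k
bernoulliTable-stable {zero}      z≤n   = refl
bernoulliTable-stable {suc n} {k} k≤1+n with ℕ.m≤n⇒m<n∨m≡n k≤1+n
... | inj₁ k<1+n = trans (bernoulliTable-suc (ℕ.≤-pred k<1+n)) (bernoulliTable-stable (ℕ.≤-pred k<1+n))
... | inj₂ refl  = refl

bernoulli-suc : ∀ n → bernoulli (suc n) ≡
  - (1/suc (suc n) * sumℚ (suc n) (λ j → binom (suc (suc n)) j * bernoulliTable n j))
bernoulli-suc n with suc n ℕ.≤? n
... | yes 1+n≤n = contradiction 1+n≤n (ℕ.n≮n n)
... | no  _     = refl

δ₁ : ℕ → ℚ
δ₁ (suc zero) = 1ℚ
δ₁ _          = 0ℚ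

sumℚ-*-δ₁ : ∀ n (g : ℕ → ℚ) → sumℚ (suc (suc n)) (λ m → g m * δ₁ m) ≡ g 1
sumℚ-*-δ₁ zero    g = first-two (g 0) (g 1)
  where
  first-two : ∀ a b → (0ℚ ⊕ a * 0ℚ) ⊕ b * 1ℚ ≡ b
  first-two = solve-∀ ℚ-ring
sumℚ-*-δ₁ (suc n) g = trans (cong₂ _⊕_ (sumℚ-*-δ₁ n g) (ℚ.*-zeroʳ (g (suc (suc n))))) (ℚ.+-identityʳ (g 1))

-- This is the defining recursion of the Bernoulli numbers.
bernoulli-binomial-sum : ∀ m → sumℚ (suc m) (λ k → binom m k * bernoulli k) ≡ bernoulli m ⊕ δ₁ m
bernoulli-binomial-sum zero          = refl
bernoulli-binomial-sum (suc zero)    = refl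
bernoulli-binomial-sum (suc (suc n)) = begin
  (sumℚ (suc n) term ⊕ term (suc n)) ⊕ term (suc (suc n))
    ≡⟨ cong₂ _⊕_ (cong₂ _⊕_ (sumℚ-cong< (suc n) (λ j j<1+n →
                                cong (binom m j *_) (sym (bernoulliTable-stable (ℕ.≤-pred j<1+n)))))
                            (cong₂ _*_ (cong ℕ→ℚ penultimate) (bernoulli-suc n)))
                 (cong (λ c → ℕ→ℚ c * bernoulli m) (ℕ.nCn≡1 m)) ⟩
  (T ⊕ ℕ→ℚ m * - (1/suc (suc n) * T)) ⊕ 1ℚ * bernoulli m
    ≡⟨ rearrange T (ℕ→ℚ m) (1/suc (suc n)) (bernoulli m) ⟩
  bernoulli m ⊕ (1ℚ - ℕ→ℚ m * 1/suc (suc n)) * T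
    ≡⟨ cong (λ t → bernoulli m ⊕ (1ℚ - t) * T) (ℕ→ℚ-suc-*-1/suc (suc n)) ⟩
  bernoulli m ⊕ (1ℚ - 1ℚ) * T
    ≡⟨ cong (bernoulli m ⊕_) (ℚ.*-zeroˡ T) ⟩
  bernoulli m ⊕ 0ℚ
    ∎
  where
  open ≡-Reasoning
  m = suc (suc n)
  term : ℕ → ℚ
  term k = binom m k * bernoulli k
  T = sumℚ (suc n) (λ j → binom m j * bernoulliTable n j)
  penultimate : m C suc n ≡ m
  penultimate = trans (ℕ.nCk≡nC[n∸k] (ℕ.n≤1+n (suc n)))
                      (trans (cong (m C_) (ℕ.m+n∸n≡m 1 n)) (ℕ.nC1≡n m))
  rearrange : ∀ t c i b → (t ⊕ c * - (i * t)) ⊕ 1ℚ * b ≡ b ⊕ (1ℚ - c * i) * t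
  rearrange = solve-∀ ℚ-ring

bernoulli-binomial-sum-extend : ∀ {m N} → m < N →
  sumℚ N (λ k → binom m k * bernoulli k) ≡ bernoulli m ⊕ δ₁ m
bernoulli-binomial-sum-extend {m} {N} m<N = begin
  sumℚ N term                     ≡⟨ cong (λ L → sumℚ L term) (ℕ.m∸n+n≡m m<N) ⟨
  sumℚ (N ∸ suc m + suc m) term   ≡⟨ sumℚ-extend (N ∸ suc m) (suc m) term
                                       (λ k m<k → trans (cong (_* bernoulli k) (binom-vanish m<k))
                                                        (ℚ.*-zeroˡ (bernoulli k))) ⟩
  sumℚ (suc m) term               ≡⟨ bernoulli-binomial-sum m ⟩
  bernoulli m ⊕ δ₁ m              ∎
  where
  open ≡-Reasoning
  term : ℕ → ℚ
  term k = binom m k * bernoulli k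

-- The rising factorials x(x+1)⋯(x+n-1) and (x+1)(x+2)⋯(x+n) evaluated umbrally, x^m ↦ B_m.
risingAtB : ℕ → ℚ
risingAtB n = sumℚ (suc (suc n)) (λ m → stirling n m * bernoulli m)

shiftedRisingAtB : ℕ → ℚ
shiftedRisingAtB n = sumℚ (suc (suc n)) (λ k → stirling (suc n) (suc k) * bernoulli k)

-- The umbral identity p(B+1) = p(B) + p'(0) for p(x) = x(x+1)⋯(x+n-1).
shiftedRisingAtB≡risingAtB+stirling : ∀ n → shiftedRisingAtB n ≡ risingAtB n ⊕ stirling n 1
shiftedRisingAtB≡risingAtB+stirling n = begin
  shiftedRisingAtB n
    ≡⟨ sumℚ-cong N (λ k → cong (_* bernoulli k) (sym (stirling-binomial-sum n k))) ⟩
  sumℚ N (λ k → sumℚ N (λ m → stirling n m * binom m k) * bernoulli k)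
    ≡⟨ sumℚ-cong N (λ k → sym (sumℚ-*ʳ N (bernoulli k) (λ m → stirling n m * binom m k))) ⟩
  sumℚ N (λ k → sumℚ N (λ m → (stirling n m * binom m k) * bernoulli k))
    ≡⟨ sumℚ-swap N N (λ k m → (stirling n m * binom m k) * bernoulli k) ⟩
  sumℚ N (λ m → sumℚ N (λ k → (stirling n m * binom m k) * bernoulli k))
    ≡⟨ sumℚ-cong N (λ m → trans (sumℚ-cong N (λ k → ℚ.*-assoc (stirling n m) (binom m k) (bernoulli k)))
                                (sumℚ-*ˡ N (stirling n m) (λ k → binom m k * bernoulli k))) ⟩
  sumℚ N (λ m → stirling n m * sumℚ N (λ k → binom m k * bernoulli k))
    ≡⟨ sumℚ-cong< N (λ m m<N → cong (stirling n m *_) (bernoulli-binomial-sum-extend m<N)) ⟩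
  sumℚ N (λ m → stirling n m * (bernoulli m ⊕ δ₁ m))
    ≡⟨ sumℚ-cong N (λ m → ℚ.*-distribˡ-+ (stirling n m) (bernoulli m) (δ₁ m)) ⟩
  sumℚ N (λ m → stirling n m * bernoulli m ⊕ stirling n m * δ₁ m)
    ≡⟨ sumℚ-+ N (λ m → stirling n m * bernoulli m) (λ m → stirling n m * δ₁ m) ⟩
  risingAtB n ⊕ sumℚ N (λ m → stirling n m * δ₁ m)
    ≡⟨ cong (risingAtB n ⊕_) (sumℚ-*-δ₁ n (stirling n)) ⟩
  risingAtB n ⊕ stirling n 1
    ∎
  where
  open ≡-Reasoning
  N = suc (suc n)

risingAtB-suc : ∀ n → risingAtB (suc n) ≡ shiftedRisingAtB (suc n) - ℕ→ℚ (suc n) * shiftedRisingAtB n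
risingAtB-suc n = begin
  risingAtB (suc n)
    ≡⟨ sumℚ-cong N (λ m → unfold (stirling (suc n) m) (stirling (suc n) (suc m)) K (bernoulli m)) ⟩
  sumℚ N (λ m → (stirling (suc n) m ⊕ K * stirling (suc n) (suc m)) * bernoulli m
                ⊕ - K * (stirling (suc n) (suc m) * bernoulli m))
    ≡⟨ sumℚ-cong N (λ m → cong (λ t → t * bernoulli m ⊕ - K * (stirling (suc n) (suc m) * bernoulli m))
                                (sym (stirling-suc (suc n) m))) ⟩
  sumℚ N (λ m → stirling (suc (suc n)) (suc m) * bernoulli m ⊕ - K * (stirling (suc n) (suc m) * bernoulli m))
    ≡⟨ sumℚ-+ N _ _ ⟩
  shiftedRisingAtB (suc n) ⊕ sumℚ N (λ m → - K * (stirling (suc n) (suc m) * bernoulli m))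
    ≡⟨ cong (shiftedRisingAtB (suc n) ⊕_) (sumℚ-*ˡ N (- K) (λ m → stirling (suc n) (suc m) * bernoulli m)) ⟩
  shiftedRisingAtB (suc n) ⊕ - K * sumℚ N (λ m → stirling (suc n) (suc m) * bernoulli m)
    ≡⟨ cong (λ t → shiftedRisingAtB (suc n) ⊕ - K * t) trailing-term-vanishes ⟩
  shiftedRisingAtB (suc n) ⊕ - K * shiftedRisingAtB n
    ≡⟨ cong (shiftedRisingAtB (suc n) ⊕_) (ℚ.neg-distribˡ-* K (shiftedRisingAtB n)) ⟨
  shiftedRisingAtB (suc n) - K * shiftedRisingAtB n
    ∎
  where
  open ≡-Reasoning
  N = suc (suc (suc n))
  K = ℕ→ℚ (suc n)
  unfold : ∀ a b k x → a * x ≡ (a ⊕ k * b) * x ⊕ - k * (b * x)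
  unfold = solve-∀ ℚ-ring
  trailing-term-vanishes : sumℚ N (λ m → stirling (suc n) (suc m) * bernoulli m) ≡ shiftedRisingAtB n
  trailing-term-vanishes = sumℚ-extend 1 (suc (suc n)) (λ m → stirling (suc n) (suc m) * bernoulli m)
    (λ m n+2≤m → trans (cong (_* bernoulli m) (stirling-vanish {suc n} (ℕ.s≤s (ℕ.<⇒≤ n+2≤m))))
                       (ℚ.*-zeroˡ (bernoulli m)))

ℕ→ℚ-suc-*-shiftedRisingAtB : ∀ n → ℕ→ℚ (suc n) * shiftedRisingAtB n ≡ ℕ→ℚ (n !)
ℕ→ℚ-suc-*-shiftedRisingAtB n = begin
  K * S
    ≡⟨ sub-sub-cancel S′ (K * S) ⟨
  S′ - (S′ - K * S)
    ≡⟨ cong (λ r → S′ - r) (risingAtB-suc n) ⟨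
  S′ - risingAtB (suc n)
    ≡⟨ cong (_- risingAtB (suc n)) (shiftedRisingAtB≡risingAtB+stirling (suc n)) ⟩
  (risingAtB (suc n) ⊕ stirling (suc n) 1) - risingAtB (suc n)
    ≡⟨ add-sub-cancelˡ (risingAtB (suc n)) (stirling (suc n) 1) ⟩
  stirling (suc n) 1
    ≡⟨ stirling-one n ⟩
  ℕ→ℚ (n !)
    ∎
  where
  open ≡-Reasoning
  K = ℕ→ℚ (suc n)
  S = shiftedRisingAtB n
  S′ = shiftedRisingAtB (suc n)
  sub-sub-cancel : ∀ a x → a - (a - x) ≡ x
  sub-sub-cancel = solve-∀ ℚ-ring
  add-sub-cancelˡ : ∀ a x → (a ⊕ x) - a ≡ x
  add-sub-cancelˡ = solve-∀ ℚ-ring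

risingAtB-closed : ∀ p → ℕ→ℚ (suc (suc p)) * risingAtB (suc p) ≡ - ℕ→ℚ (p !)
risingAtB-closed p = begin
  K₂ * R
    ≡⟨ cong (K₂ *_) (add-sub-cancelʳ R (stirling (suc p) 1)) ⟨
  K₂ * ((R ⊕ stirling (suc p) 1) - stirling (suc p) 1)
    ≡⟨ cong₂ (λ s u → K₂ * (s - u)) (sym (shiftedRisingAtB≡risingAtB+stirling (suc p))) (stirling-one p) ⟩
  K₂ * (S′ - F)
    ≡⟨ *-distribˡ-sub K₂ S′ F ⟩
  K₂ * S′ - K₂ * F
    ≡⟨ cong₂ (λ a k → a - k * F) (trans (ℕ→ℚ-suc-*-shiftedRisingAtB (suc p)) (ℕ→ℚ-* (suc p) (p !)))
                                 (ℕ→ℚ-suc (suc p)) ⟩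
  K₁ * F - (1ℚ ⊕ K₁) * F
    ≡⟨ difference K₁ F ⟩
  - F
    ∎
  where
  open ≡-Reasoning
  K₁ = ℕ→ℚ (suc p)
  K₂ = ℕ→ℚ (suc (suc p))
  R = risingAtB (suc p)
  S′ = shiftedRisingAtB (suc p)
  F = ℕ→ℚ (p !)
  add-sub-cancelʳ : ∀ a x → (a ⊕ x) - x ≡ a
  add-sub-cancelʳ = solve-∀ ℚ-ring
  difference : ∀ k f → k * f - (1ℚ ⊕ k) * f ≡ - f
  difference = solve-∀ ℚ-ring

risingFactorial : ℕ → ℕ → ℕ
risingFactorial x zero    = 1
risingFactorial x (suc k) = x ℕ.* risingFactorial (suc x) k

risingFactorial-sucʳ : ∀ x k → risingFactorial x (suc k) ≡ risingFactorial x k ℕ.* (x + k)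
risingFactorial-sucʳ x zero    =
  trans (ℕ.*-identityʳ x) (trans (sym (ℕ.+-identityʳ x)) (sym (ℕ.*-identityˡ (x + 0))))
risingFactorial-sucʳ x (suc k) = begin
  x ℕ.* risingFactorial (suc x) (suc k)
    ≡⟨ cong (x ℕ.*_) (risingFactorial-sucʳ (suc x) k) ⟩
  x ℕ.* (risingFactorial (suc x) k ℕ.* (suc x + k))
    ≡⟨ ℕ.*-assoc x _ _ ⟨
  x ℕ.* risingFactorial (suc x) k ℕ.* (suc x + k)
    ≡⟨ cong (x ℕ.* risingFactorial (suc x) k ℕ.*_) (ℕ.+-suc x k) ⟨
  x ℕ.* risingFactorial (suc x) k ℕ.* (x + suc k)
    ∎
  where open ≡-Reasoning

risingFactorial-one : ∀ k → risingFactorial 1 k ≡ k !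
risingFactorial-one zero    = refl
risingFactorial-one (suc k) = begin
  risingFactorial 1 (suc k)          ≡⟨ risingFactorial-sucʳ 1 k ⟩
  risingFactorial 1 k ℕ.* suc k      ≡⟨ cong (ℕ._* suc k) (risingFactorial-one k) ⟩
  k ! ℕ.* suc k                      ≡⟨ ℕ.*-comm (k !) (suc k) ⟩
  suc k !                            ∎
  where open ≡-Reasoning

betaTerm : ℕ → ℕ → ℕ → ℚ
betaTerm p r j = sign j * (binom p j * 1/suc (r + j))

-- The Beta integral ∫₀¹ x^r (1-x)^p dx, expanded by the binomial theorem.
betaSum : ℕ → ℕ → ℚ
betaSum p r = sumℚ (suc p) (betaTerm p r)

-- Mirrors x^r (1-x)^(p+1) = x^r (1-x)^p - x^(r+1) (1-x)^p.
betaSum-suc : ∀ p r → betaSum (suc p) r ≡ betaSum p r - betaSum p (suc r)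
betaSum-suc p r = begin
  betaSum (suc p) r
    ≡⟨ sumℚ-suc-head (suc p) (betaTerm (suc p) r) ⟩
  betaTerm p r 0 ⊕ sumℚ (suc p) (λ j → betaTerm (suc p) r (suc j))
    ≡⟨ cong (betaTerm p r 0 ⊕_) (trans (sumℚ-cong (suc p) pascal-split) (sumℚ-+ (suc p) _ _)) ⟩
  betaTerm p r 0 ⊕ (sumℚ (suc p) (λ j → - betaTerm p (suc r) j) ⊕ X)
    ≡⟨ cong (λ t → betaTerm p r 0 ⊕ (t ⊕ X)) (sumℚ-neg (suc p) (betaTerm p (suc r))) ⟩
  betaTerm p r 0 ⊕ (- betaSum p (suc r) ⊕ X)
    ≡⟨ rearrange (betaTerm p r 0) (betaSum p (suc r)) X ⟩
  (betaTerm p r 0 ⊕ X) - betaSum p (suc r)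
    ≡⟨ cong (_- betaSum p (suc r)) (sumℚ-suc-head (suc p) (betaTerm p r)) ⟨
  sumℚ (suc (suc p)) (betaTerm p r) - betaSum p (suc r)
    ≡⟨ cong (_- betaSum p (suc r)) (sumℚ-extend 1 (suc p) (betaTerm p r) beyond-p) ⟩
  betaSum p r - betaSum p (suc r)
    ∎
  where
  open ≡-Reasoning
  X = sumℚ (suc p) (λ j → betaTerm p r (suc j))
  rearrange : ∀ h b x → h ⊕ (- b ⊕ x) ≡ (h ⊕ x) - b
  rearrange = solve-∀ ℚ-ring
  split : ∀ s a b i → - s * ((a ⊕ b) * i) ≡ - (s * (a * i)) ⊕ - s * (b * i)
  split = solve-∀ ℚ-ring
  pascal-split : ∀ j → betaTerm (suc p) r (suc j) ≡ - betaTerm p (suc r) j ⊕ betaTerm p r (suc j)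
  pascal-split j = begin
    - sign j * (binom (suc p) (suc j) * 1/suc (r + suc j))
      ≡⟨ cong (λ b → - sign j * (b * 1/suc (r + suc j))) (binom-pascal p j) ⟩
    - sign j * ((binom p j ⊕ binom p (suc j)) * 1/suc (r + suc j))
      ≡⟨ split (sign j) (binom p j) (binom p (suc j)) (1/suc (r + suc j)) ⟩
    - (sign j * (binom p j * 1/suc (r + suc j))) ⊕ - sign j * (binom p (suc j) * 1/suc (r + suc j))
      ≡⟨ cong (λ k → - (sign j * (binom p j * 1/suc k)) ⊕ betaTerm p r (suc j)) (ℕ.+-suc r j) ⟩
    - betaTerm p (suc r) j ⊕ betaTerm p r (suc j)
      ∎
  beyond-p : ∀ j → suc p ≤ j → betaTerm p r j ≡ 0ℚ
  beyond-p j p<j = begin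
    sign j * (binom p j * 1/suc (r + j))   ≡⟨ cong (λ b → sign j * (b * 1/suc (r + j))) (binom-vanish p<j) ⟩
    sign j * (0ℚ * 1/suc (r + j))          ≡⟨ cong (sign j *_) (ℚ.*-zeroˡ (1/suc (r + j))) ⟩
    sign j * 0ℚ                            ≡⟨ ℚ.*-zeroʳ (sign j) ⟩
    0ℚ                                     ∎

betaSum-closed : ∀ p r → ℕ→ℚ (risingFactorial (suc r) (suc p)) * betaSum p r ≡ ℕ→ℚ (p !)
betaSum-closed zero r = begin
  ℕ→ℚ (suc r ℕ.* 1) * (0ℚ ⊕ 1ℚ * (1ℚ * 1/suc (r + 0)))
    ≡⟨ cong₂ (λ a k → ℕ→ℚ a * (0ℚ ⊕ 1ℚ * (1ℚ * 1/suc k))) (ℕ.*-identityʳ (suc r)) (ℕ.+-identityʳ r) ⟩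
  ℕ→ℚ (suc r) * (0ℚ ⊕ 1ℚ * (1ℚ * 1/suc r))
    ≡⟨ simplify (ℕ→ℚ (suc r)) (1/suc r) ⟩
  ℕ→ℚ (suc r) * 1/suc r
    ≡⟨ ℕ→ℚ-suc-*-1/suc r ⟩
  1ℚ
    ∎
  where
  open ≡-Reasoning
  simplify : ∀ a i → a * (0ℚ ⊕ 1ℚ * (1ℚ * i)) ≡ a * i
  simplify = solve-∀ ℚ-ring
betaSum-closed (suc p) r = begin
  P * betaSum (suc p) r
    ≡⟨ cong (P *_) (betaSum-suc p r) ⟩
  P * (β₀ - β₁)
    ≡⟨ *-distribˡ-sub P β₀ β₁ ⟩
  P * β₀ - P * β₁
    ≡⟨ cong₂ (λ a b → a * β₀ - b * β₁) P≡top P≡bottom ⟩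
  α * (R ⊕ K) * β₀ - R * α′ * β₁
    ≡⟨ regroup α (R ⊕ K) β₀ R α′ β₁ ⟩
  (R ⊕ K) * (α * β₀) - R * (α′ * β₁)
    ≡⟨ cong₂ (λ a b → (R ⊕ K) * a - R * b) (betaSum-closed p r) (betaSum-closed p (suc r)) ⟩
  (R ⊕ K) * F - R * F
    ≡⟨ difference R K F ⟩
  K * F
    ≡⟨ ℕ→ℚ-* (suc p) (p !) ⟨
  ℕ→ℚ (suc p !)
    ∎
  where
  open ≡-Reasoning
  P = ℕ→ℚ (risingFactorial (suc r) (suc (suc p)))
  α = ℕ→ℚ (risingFactorial (suc r) (suc p))
  α′ = ℕ→ℚ (risingFactorial (suc (suc r)) (suc p))
  β₀ = betaSum p r
  β₁ = betaSum p (suc r)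
  R = ℕ→ℚ (suc r)
  K = ℕ→ℚ (suc p)
  F = ℕ→ℚ (p !)
  P≡top : P ≡ α * (R ⊕ K)
  P≡top = trans (cong ℕ→ℚ (risingFactorial-sucʳ (suc r) (suc p)))
                (trans (ℕ→ℚ-* (risingFactorial (suc r) (suc p)) (suc r + suc p))
                       (cong (α *_) (ℕ→ℚ-+ (suc r) (suc p))))
  P≡bottom : P ≡ R * α′
  P≡bottom = ℕ→ℚ-* (suc r) (risingFactorial (suc (suc r)) (suc p))
  regroup : ∀ a l b₀ r a′ b₁ → a * l * b₀ - r * a′ * b₁ ≡ l * (a * b₀) - r * (a′ * b₁)
  regroup = solve-∀ ℚ-ring
  difference : ∀ r k f → (r ⊕ k) * f - r * f ≡ k * f
  difference = solve-∀ ℚ-ring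

lhs-closed : ∀ p → ℕ→ℚ (suc (suc p)) *
  sumℚ (suc (suc p)) (λ m → sign m * (ℕ→ℚ (p C (suc p ∸ m)) * ((+ (suc p !)) / suc m)))
  ≡ - ℕ→ℚ (p !)
lhs-closed p = begin
  K₂ * sumℚ (suc (suc p)) term
    ≡⟨ cong (K₂ *_) (sumℚ-suc-head (suc p) term) ⟩
  K₂ * (term 0 ⊕ sumℚ (suc p) (λ j → term (suc j)))
    ≡⟨ cong (λ t → K₂ * t) (cong₂ _⊕_ first-term-vanishes
         (trans (sumℚ-cong< (suc p) reindex) (sumℚ-*ˡ (suc p) (- F′) (betaTerm p 1)))) ⟩
  K₂ * (0ℚ ⊕ - F′ * betaSum p 1)
    ≡⟨ regroup K₂ F′ (betaSum p 1) ⟩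
  - (K₂ * F′ * betaSum p 1)
    ≡⟨ cong (λ t → - (t * betaSum p 1)) K₂*F′≡rising ⟩
  - (ℕ→ℚ (risingFactorial 2 (suc p)) * betaSum p 1)
    ≡⟨ cong -_ (betaSum-closed p 1) ⟩
  - ℕ→ℚ (p !)
    ∎
  where
  open ≡-Reasoning
  K₂ = ℕ→ℚ (suc (suc p))
  F′ = ℕ→ℚ (suc p !)
  term : ℕ → ℚ
  term m = sign m * (ℕ→ℚ (p C (suc p ∸ m)) * ((+ (suc p !)) / suc m))

  first-term-vanishes : term 0 ≡ 0ℚ
  first-term-vanishes = trans (cong (λ c → 1ℚ * (c * ((+ (suc p !)) / 1))) (binom-vanish (ℕ.n<1+n p)))
                              (trans (cong (1ℚ *_) (ℚ.*-zeroˡ ((+ (suc p !)) / 1))) (ℚ.*-zeroʳ 1ℚ))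

  reindex : ∀ j → j < suc p → term (suc j) ≡ - F′ * betaTerm p 1 j
  reindex j j<1+p = begin
    - sign j * (ℕ→ℚ (p C (p ∸ j)) * ((+ (suc p !)) / suc (suc j)))
      ≡⟨ cong₂ (λ c x → - sign j * (ℕ→ℚ c * x)) (sym (ℕ.nCk≡nC[n∸k] (ℕ.≤-pred j<1+p)))
                                              (/suc≡*1/suc (suc p !) (suc j)) ⟩
    - sign j * (binom p j * (F′ * 1/suc (suc j)))
      ≡⟨ pull-out (sign j) (binom p j) F′ (1/suc (suc j)) ⟩
    - F′ * betaTerm p 1 j
      ∎
    where
    pull-out : ∀ s c f i → - s * (c * (f * i)) ≡ - f * (s * (c * i))
    pull-out = solve-∀ ℚ-ring

  regroup : ∀ k f b → k * (0ℚ ⊕ - f * b) ≡ - (k * f * b)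
  regroup = solve-∀ ℚ-ring

  K₂*F′≡rising : K₂ * F′ ≡ ℕ→ℚ (risingFactorial 2 (suc p))
  K₂*F′≡rising = trans (sym (ℕ→ℚ-* (suc (suc p)) (suc p !)))
                       (cong ℕ→ℚ (sym (trans (sym (ℕ.*-identityˡ _)) (risingFactorial-one (suc (suc p))))))

rhs-closed : ∀ p → ℕ→ℚ (suc (suc p)) *
  sumℚ (suc (suc (suc p))) (λ m → sign (m + suc p) * (ℤ→ℚ (S₁ (suc p) m) * bernoulli m))
  ≡ - ℕ→ℚ (p !)
rhs-closed p =
  trans (cong (ℕ→ℚ (suc (suc p)) *_) (sumℚ-cong (suc (suc (suc p))) reassociate)) (risingAtB-closed p)
  where
  reassociate : ∀ m → sign (m + suc p) * (ℤ→ℚ (S₁ (suc p) m) * bernoulli m) ≡ stirling (suc p) m * bernoulli m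
  reassociate m = sym (ℚ.*-assoc (sign (m + suc p)) (ℤ→ℚ (S₁ (suc p) m)) (bernoulli m))

mainTheorem16 : (n : ℕ) → .{{_ : NonZero n}} →
    sumℚ (suc n) (λ m → sign m * (ℕ→ℚ ((n ∸ 1) C (n ∸ m)) * ((+ (n !)) / suc m)))
      ≡ sumℚ (suc (suc n)) (λ m → sign (m + n) * (ℤ→ℚ (S₁ n m) * bernoulli m))
mainTheorem16 (suc p) = ℕ→ℚ-suc-*-cancelˡ (suc p) (trans (lhs-closed p) (sym (rhs-closed p)))
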